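{- Let $\{a(n)\}_{n\geq 0}$ be Stern's diatomic sequence, defined by $a(0)=0$, $a(1)=1$, and for $n\geq 1$ by $a(2n)=a(n)$ and $a(2n+1)=a(n)+a(n+1)$. For $n\geq 2$ let $m_n=\frac{1}{3}(2^n-(-1)^n)$ (so $m_2=1<m_3=3<m_4=5<m_5=11<\cdots$), and let $h:\mathbb{R}_{\geq 0}\to\mathbb{R}_{\geq 0}$ be the continuous piecewise linear function whose graph connects, in order of increasing first coordinate, the points $(0,0)$ and $(m_n,a(m_n))$ for $n\geq 2$ (i.e. $h(0)=0$, $h(m_n)=a(m_n)$, and $h$ is affine on $[0,m_2]$ and on each $[m_n,m_{n+1}]$). Then $a(m)\leq h(m)$ for every nonnegative integer $m$, and moreover $$\limsup_{m\to\infty}\frac{a(m)}{h(m)}=1,$$ where the limsup is over integers $m$. -}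

module Defs where

open import Data.Nat as ℕ using (ℕ; zero; suc; _+_; _*_; _∸_; _^_; _<ᵇ_; _≡ᵇ_; _%_; _/_)
open import Data.Bool using (if_then_else_)
open import Data.Integer as ℤ using (ℤ; +_)
open import Data.Rational as ℚ using (ℚ; 0ℚ; 1ℚ; _≟_; _÷_; ≢-nonZero)
open import Data.Product using (Σ; ∃; _×_)
open import Relation.Nullary using (yes; no)

-- Defined directly by the recursion a(0)=0, a(1)=1, a(2n)=a(n), a(2n+1)=a(n)+a(n+1),
-- using fuel (fuel n suffices since halving strictly decreases positive arguments).
sternF : ℕ → ℕ → ℕ
sternF zero    n = 0
sternF (suc f) zero = 0
sternF (suc f) (suc zero) = 1
sternF (suc f) n@(suc (suc _)) =
  if n % 2 ≡ᵇ 0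
  then sternF f (n / 2)
  else sternF f (n / 2) + sternF f (suc (n / 2))

a : ℕ → ℕ
a n = sternF (suc n) n

mSeq : ℕ → ℕ
mSeq n = if n % 2 ≡ᵇ 0 then (2 ^ n ∸ 1) / 3 else (2 ^ n + 1) / 3

segFrom : ℕ → ℕ → ℕ → ℕ
segFrom zero    n m = n
segFrom (suc f) n m = if m <ᵇ mSeq (suc n) then n else segFrom f (suc n) m

-- for m ≥ 1 = m_2: the n ≥ 2 with m_n ≤ m < m_{n+1}
seg : ℕ → ℕ
seg m = segFrom m 2 m

-- p / d as a rational; only used with d > 0 (the d = 0 clause is never reached)
frac : ℤ → ℕ → ℚ
frac p zero    = 0ℚ
frac p (suc d) = p ℚ./ suc d

h : ℕ → ℚ
h zero = 0ℚ
h m@(suc _) =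
  let n  = seg m
      lo = mSeq n
      hi = mSeq (suc n)
      d  = hi ∸ lo
  in frac ((+ (a lo * d)) ℤ.+ (+ (m ∸ lo)) ℤ.* ((+ a hi) ℤ.- (+ a lo))) d

toℚ : ℕ → ℚ
toℚ n = (+ n) ℚ./ 1

-- the ratio a(m)/h(m) (defined as 0 in the case h(m) = 0, which only happens at m = 0)
ratio : ℕ → ℚ
ratio m with h m ≟ 0ℚ
... | yes _ = 0ℚ
... | no h≢0 = toℚ (a m) ÷ h m
  where instance _ = ≢-nonZero h≢0

LimsupEq : (ℕ → ℚ) → ℚ → Set
LimsupEq f L =
  (∀ (ε : ℚ) → 0ℚ ℚ.< ε → ∃ λ N → ∀ m → N ℕ.≤ m → f m ℚ.< L ℚ.+ ε) ×
  (∀ (ε : ℚ) → 0ℚ ℚ.< ε → ∀ N → ∃ λ m → N ℕ.≤ m × L ℚ.- ε ℚ.< f m)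

module Submission where

-- Write J n = m_n (Jacobsthal numbers) and F n for the Fibonacci numbers. Since a (J n) = F n, h is the
-- polygon through the points (J n , F n); the slopes F (n − 1) / (2 J (n − 1)) of its pieces decrease, so h
-- is concave and on [J n , J (n + 1)] chord n is the lowest of all chords. By strong induction every point
-- (m , a m) lies below every chord. Write m = 2^r + c with c < 2^r. If c ≤ J r then
-- a m = a (2^(r−1) − c) + 2 a c, and bounding both terms by chord (r − 1) gives a line through
-- (J (r + 2) , F (r + 2)) steeper than chord (r + 1), hence below it on [2^r , J (r + 2)]. If c ≥ J r then
-- a m = a c + a (2^r − c), and chord r at c and at 2^r − c sums to F (r + 2) = h (J (r + 2)) ≤ h m.
-- Finally a (J n) = h (J n) for all n ≥ 2, which gives the limsup.

module SternSequence where
  open import Data.Bool.Base using (true; false)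
  open import Data.Nat.Base
  open import Data.Nat.DivMod
  open import Data.Nat.Properties
  open import Data.Nat.Tactic.RingSolver using (solve-∀)
  open import Data.Product.Base using (∃-syntax; _,_)
  open import Data.Sum.Base using (_⊎_; inj₁; inj₂)
  open import Relation.Binary.PropositionalEquality
  open import Relation.Nullary.Negation using (contradiction)

  open import Defs using (sternF; a)

  private
    half-suc-suc : ∀ n → suc (suc n) / 2 ≡ suc (n / 2)
    half-suc-suc n = m/n≡1+[m∸n]/n {suc (suc n)} {2} (s≤s (s≤s z≤n))

    half+1<3+n : ∀ n → suc (suc (suc (suc n)) / 2) < suc (suc (suc n))
    half+1<3+n n rewrite half-suc-suc (suc n) = s≤s (s≤s (m/n<m (suc n) 2 (s≤s (s≤s z≤n))))

    half<3+n : ∀ n → suc (suc (suc n)) / 2 < suc (suc (suc n))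
    half<3+n n = ≤-trans (n≤1+n _) (half+1<3+n n)

  sternF-fuel-irrelevant : ∀ {f g} n → n < f → n < g → sternF f n ≡ sternF g n
  sternF-fuel-irrelevant {suc f} {suc g} zero       _ _ = refl
  sternF-fuel-irrelevant {suc f} {suc g} (suc zero) _ _ = refl
  sternF-fuel-irrelevant {suc (suc f)} {suc (suc g)} (suc (suc zero)) _ _ = refl
  sternF-fuel-irrelevant {suc zero} (suc (suc zero)) (s≤s ()) _
  sternF-fuel-irrelevant {suc (suc f)} {suc zero} (suc (suc zero)) _ (s≤s ())
  sternF-fuel-irrelevant {suc f} {suc g} (suc (suc (suc n))) (s≤s n<f) (s≤s n<g) with suc n % 2 ≡ᵇ 0
  ... | true  = sternF-fuel-irrelevant _ (<-≤-trans (half<3+n n) n<f) (<-≤-trans (half<3+n n) n<g)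
  ... | false = cong₂ _+_
    (sternF-fuel-irrelevant _ (<-≤-trans (half<3+n n) n<f) (<-≤-trans (half<3+n n) n<g))
    (sternF-fuel-irrelevant _ (<-≤-trans (half+1<3+n n) n<f) (<-≤-trans (half+1<3+n n) n<g))

  2*n%2≡0 : ∀ n → 2 * n % 2 ≡ 0
  2*n%2≡0 n rewrite *-comm 2 n = m*n%n≡0 n 2

  2*n/2≡n : ∀ n → 2 * n / 2 ≡ n
  2*n/2≡n n rewrite *-comm 2 n = m*n/n≡m n 2

  [1+2*n]%2≡1 : ∀ n → suc (2 * n) % 2 ≡ 1
  [1+2*n]%2≡1 n rewrite *-comm 2 n = [m+kn]%n≡m%n 1 n 2

  [1+2*n]/2≡n : ∀ n → suc (2 * n) / 2 ≡ n
  [1+2*n]/2≡n zero    = refl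
  [1+2*n]/2≡n (suc n) = begin
    suc (2 * suc n) / 2          ≡⟨ cong (λ k → suc k / 2) (*-suc 2 n) ⟩
    suc (suc (suc (2 * n))) / 2  ≡⟨ half-suc-suc (suc (2 * n)) ⟩
    suc (suc (2 * n) / 2)        ≡⟨ cong suc ([1+2*n]/2≡n n) ⟩
    suc n                        ∎
    where open ≡-Reasoning

  private
    sternF-even : ∀ f x → x % 2 ≡ 0 → sternF (suc f) (suc (suc x)) ≡ sternF f (suc (x / 2))
    sternF-even f x x%2≡0 rewrite x%2≡0 | half-suc-suc x = refl

    sternF-odd : ∀ f x → x % 2 ≡ 1 →
      sternF (suc f) (suc (suc x)) ≡ sternF f (suc (x / 2)) + sternF f (suc (suc (x / 2)))
    sternF-odd f x x%2≡1 rewrite x%2≡1 | half-suc-suc x = refl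

  a-double : ∀ n → a (2 * n) ≡ a n
  a-double zero    = refl
  a-double (suc n) = begin
    a (2 * suc n)                                 ≡⟨ cong a (*-suc 2 n) ⟩
    sternF (3 + 2 * n) (2 + 2 * n)                ≡⟨ sternF-even (2 + 2 * n) (2 * n) (2*n%2≡0 n) ⟩
    sternF (2 + 2 * n) (suc (2 * n / 2))          ≡⟨ cong (λ k → sternF (2 + 2 * n) (suc k)) (2*n/2≡n n) ⟩
    sternF (2 + 2 * n) (suc n)                    ≡⟨ sternF-fuel-irrelevant (suc n) (s≤s (s≤s (m≤n*m n 2))) ≤-refl ⟩
    a (suc n)                                     ∎
    where open ≡-Reasoning

  a-double+1 : ∀ n → a (suc (2 * n)) ≡ a n + a (suc n)
  a-double+1 zero    = refl
  a-double+1 (suc n) = begin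
    a (suc (2 * suc n))                  ≡⟨ cong (λ k → a (suc k)) (*-suc 2 n) ⟩
    sternF (suc f) f                     ≡⟨ sternF-odd f (suc (2 * n)) ([1+2*n]%2≡1 n) ⟩
    sternF f (suc q) + sternF f (2 + q)  ≡⟨ cong (λ k → sternF f (suc k) + sternF f (2 + k)) ([1+2*n]/2≡n n) ⟩
    sternF f (suc n) + sternF f (2 + n)  ≡⟨ cong₂ _+_ (sternF-fuel-irrelevant (suc n) n+1<f ≤-refl)
                                                      (sternF-fuel-irrelevant (2 + n) n+2<f ≤-refl) ⟩
    a (suc n) + a (2 + n)                ∎
    where
    open ≡-Reasoning
    f = 3 + 2 * n
    q = suc (2 * n) / 2
    n+2<f : 2 + n < f
    n+2<f = s≤s (s≤s (s≤s (m≤n*m n 2)))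
    n+1<f : suc n < f
    n+1<f = ≤-trans (n≤1+n _) n+2<f

  even-or-odd : ∀ n → (∃[ k ] n ≡ 2 * k) ⊎ (∃[ k ] n ≡ suc (2 * k))
  even-or-odd zero = inj₁ (0 , refl)
  even-or-odd (suc n) with even-or-odd n
  ... | inj₁ (k , refl) = inj₂ (k , refl)
  ... | inj₂ (k , refl) = inj₁ (suc k , cong suc (sym (+-suc k (k + 0))))

  a-2^j*k+c : ∀ j k {c d} → c + d ≡ 2 ^ j → a (2 ^ j * k + c) ≡ a d * a k + a c * a (suc k)
  a-2^j*k+c zero k {zero} {suc zero} refl = trans (cong a (1*x+0≡x k)) (sym (1*x+0≡x (a k)))
    where
    1*x+0≡x : ∀ x → 1 * x + 0 ≡ x
    1*x+0≡x = solve-∀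
  a-2^j*k+c zero k {suc zero} {zero} refl = trans (cong a (1*x+1≡1+x k)) (sym (*-identityˡ (a (suc k))))
    where
    1*x+1≡1+x : ∀ x → 1 * x + 1 ≡ suc x
    1*x+1≡1+x = solve-∀
  a-2^j*k+c zero k {zero} {zero} ()
  a-2^j*k+c zero k {zero} {suc (suc d)} ()
  a-2^j*k+c zero k {suc zero} {suc d} ()
  a-2^j*k+c zero k {suc (suc c)} ()
  a-2^j*k+c (suc j) k {c} {d} c+d≡2^j+1 with even-or-odd c | even-or-odd d
  ... | inj₁ (c′ , refl) | inj₁ (d′ , refl) = begin
    a (2 ^ suc j * k + 2 * c′)                    ≡⟨ cong a (distrib (2 ^ j) k c′) ⟩
    a (2 * (2 ^ j * k + c′))                      ≡⟨ a-double (2 ^ j * k + c′) ⟩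
    a (2 ^ j * k + c′)                            ≡⟨ a-2^j*k+c j k c′+d′≡2^j ⟩
    a d′ * a k + a c′ * a (suc k)                 ≡⟨ cong₂ (λ x y → x * a k + y * a (suc k)) (a-double d′) (a-double c′) ⟨
    a (2 * d′) * a k + a (2 * c′) * a (suc k)     ∎
    where
    open ≡-Reasoning
    distrib : ∀ p k c → 2 * p * k + 2 * c ≡ 2 * (p * k + c)
    distrib = solve-∀
    c′+d′≡2^j : c′ + d′ ≡ 2 ^ j
    c′+d′≡2^j = *-cancelˡ-≡ (c′ + d′) (2 ^ j) 2 (trans (*-distribˡ-+ 2 c′ d′) c+d≡2^j+1)
  ... | inj₂ (c′ , refl) | inj₂ (d′ , refl) = begin
    a (2 ^ suc j * k + suc (2 * c′))              ≡⟨ cong a (distrib (2 ^ j) k c′) ⟩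
    a (suc (2 * (2 ^ j * k + c′)))                ≡⟨ a-double+1 (2 ^ j * k + c′) ⟩
    a (2 ^ j * k + c′) + a (suc (2 ^ j * k + c′)) ≡⟨ cong₂ _+_ (a-2^j*k+c j k (trans (+-suc c′ d′) c′+d′+1≡2^j))
                                                              (trans (cong a (sym (+-suc (2 ^ j * k) c′)))
                                                                     (a-2^j*k+c j k {suc c′} {d′} c′+d′+1≡2^j)) ⟩
    (a (suc d′) * a k + a c′ * a (suc k)) + (a d′ * a k + a (suc c′) * a (suc k))
                                                  ≡⟨ regroup (a c′) (a (suc c′)) (a d′) (a (suc d′)) (a k) (a (suc k)) ⟩
    (a d′ + a (suc d′)) * a k + (a c′ + a (suc c′)) * a (suc k)
                                                  ≡⟨ cong₂ (λ x y → x * a k + y * a (suc k)) (a-double+1 d′) (a-double+1 c′) ⟨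
    a (suc (2 * d′)) * a k + a (suc (2 * c′)) * a (suc k) ∎
    where
    open ≡-Reasoning
    distrib : ∀ p k c → 2 * p * k + suc (2 * c) ≡ suc (2 * (p * k + c))
    distrib = solve-∀
    regroup : ∀ x x′ y y′ u v → (y′ * u + x * v) + (y * u + x′ * v) ≡ (y + y′) * u + (x + x′) * v
    regroup = solve-∀
    odd+odd : ∀ c d → suc (2 * c) + suc (2 * d) ≡ 2 * (suc c + d)
    odd+odd = solve-∀
    c′+d′+1≡2^j : suc c′ + d′ ≡ 2 ^ j
    c′+d′+1≡2^j = *-cancelˡ-≡ (suc c′ + d′) (2 ^ j) 2 (trans (sym (odd+odd c′ d′)) c+d≡2^j+1)
  ... | inj₁ (c′ , refl) | inj₂ (d′ , refl) =
    contradiction (trans (sym c+d≡2^j+1) (even+odd c′ d′)) (even≢odd (2 ^ j) (c′ + d′))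
    where
    even+odd : ∀ c d → 2 * c + suc (2 * d) ≡ suc (2 * (c + d))
    even+odd = solve-∀
  ... | inj₂ (c′ , refl) | inj₁ (d′ , refl) =
    contradiction (trans (sym c+d≡2^j+1) (odd+even c′ d′)) (even≢odd (2 ^ j) (c′ + d′))
    where
    odd+even : ∀ c d → suc (2 * c) + 2 * d ≡ suc (2 * (c + d))
    odd+even = solve-∀

  a-2^j+c : ∀ j {c} → c ≤ 2 ^ j → a (2 ^ j + c) ≡ a (2 ^ j ∸ c) + a c
  a-2^j+c j {c} c≤2^j = begin
    a (2 ^ j + c)                      ≡⟨ cong (λ x → a (x + c)) (*-identityʳ (2 ^ j)) ⟨
    a (2 ^ j * 1 + c)                  ≡⟨ a-2^j*k+c j 1 (m+[n∸m]≡n c≤2^j) ⟩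
    a (2 ^ j ∸ c) * 1 + a c * 1        ≡⟨ cong₂ _+_ (*-identityʳ (a (2 ^ j ∸ c))) (*-identityʳ (a c)) ⟩
    a (2 ^ j ∸ c) + a c                ∎
    where open ≡-Reasoning

  a-2^[1+j]+c : ∀ j {c} → c ≤ 2 ^ j → a (2 ^ suc j + c) ≡ a (2 ^ j ∸ c) + 2 * a c
  a-2^[1+j]+c j {c} c≤2^j = begin
    a (2 ^ suc j + c)                  ≡⟨ cong (λ x → a (x + c)) (*-comm 2 (2 ^ j)) ⟩
    a (2 ^ j * 2 + c)                  ≡⟨ a-2^j*k+c j 2 (m+[n∸m]≡n c≤2^j) ⟩
    a (2 ^ j ∸ c) * 1 + a c * 2        ≡⟨ cong₂ _+_ (*-identityʳ (a (2 ^ j ∸ c))) (*-comm (a c) 2) ⟩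
    a (2 ^ j ∸ c) + 2 * a c            ∎
    where open ≡-Reasoning

module FibonacciJacobsthal where
  open import Data.Nat.Base
  open import Data.Nat.DivMod using (m*n/n≡m)
  open import Data.Nat.Properties
  open import Data.Nat.Tactic.RingSolver using (solve-∀)
  open import Data.Product.Base using (_,_)
  open import Data.Sum.Base using (inj₁; inj₂)
  open import Relation.Binary.PropositionalEquality

  open import Defs using (a; mSeq)
  open SternSequence

  fib : ℕ → ℕ
  fib 0             = 0
  fib 1             = 1
  fib (suc (suc n)) = fib (suc n) + fib n

  -- Jacobsthal numbers, the paper's m_n (see mSeq≡jac). The recurrence doubles by addition so that
  -- + jac (2 + n) unfolds definitionally to a sum of integers, as the ring identities below expect.
  jac : ℕ → ℕ
  jac 0             = 0
  jac 1             = 1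
  jac (suc (suc n)) = jac (suc n) + (jac n + jac n)

  2^n≡jac[n]+jac[1+n] : ∀ n → 2 ^ n ≡ jac n + jac (suc n)
  2^n≡jac[n]+jac[1+n] zero    = refl
  2^n≡jac[n]+jac[1+n] (suc n) = begin
    2 * 2 ^ n                                   ≡⟨ cong (2 *_) (2^n≡jac[n]+jac[1+n] n) ⟩
    2 * (jac n + jac (suc n))                   ≡⟨ regroup (jac n) (jac (suc n)) ⟩
    jac (suc n) + (jac (suc n) + (jac n + jac n)) ∎
    where
    open ≡-Reasoning
    regroup : ∀ x y → 2 * (x + y) ≡ y + (y + (x + x))
    regroup = solve-∀

  jac[1+n]≤2^n : ∀ n → jac (suc n) ≤ 2 ^ n
  jac[1+n]≤2^n n = ≤-trans (m≤n+m (jac (suc n)) (jac n)) (≤-reflexive (sym (2^n≡jac[n]+jac[1+n] n)))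

  2^n+jac[n]≡jac[2+n] : ∀ n → 2 ^ n + jac n ≡ jac (2 + n)
  2^n+jac[n]≡jac[2+n] n = trans (cong (_+ jac n) (2^n≡jac[n]+jac[1+n] n)) (regroup (jac n) (jac (suc n)))
    where
    regroup : ∀ x y → x + y + x ≡ y + (x + x)
    regroup = solve-∀

  2^n≤jac[2+n] : ∀ n → 2 ^ n ≤ jac (2 + n)
  2^n≤jac[2+n] n = ≤-trans (m≤m+n (2 ^ n) (jac n)) (≤-reflexive (2^n+jac[n]≡jac[2+n] n))

  jac-even-step : ∀ k → jac (suc (2 * k)) ≡ suc (2 * jac (2 * k))
  jac-odd-step  : ∀ k → suc (jac (2 + 2 * k)) ≡ 2 * jac (suc (2 * k))

  jac-even-step zero    = refl
  jac-even-step (suc k) = begin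
    jac (suc (2 * suc k))                                   ≡⟨ cong (λ i → jac (suc i)) (*-suc 2 k) ⟩
    jac (2 + 2 * k) + (jac (suc (2 * k)) + jac (suc (2 * k))) ≡⟨ regroup (jac (2 + 2 * k)) (jac (suc (2 * k))) ⟩
    jac (2 + 2 * k) + 2 * jac (suc (2 * k))                 ≡⟨ cong (jac (2 + 2 * k) +_) (jac-odd-step k) ⟨
    jac (2 + 2 * k) + suc (jac (2 + 2 * k))                 ≡⟨ double (jac (2 + 2 * k)) ⟩
    suc (2 * jac (2 + 2 * k))                               ≡⟨ cong (λ i → suc (2 * jac i)) (*-suc 2 k) ⟨
    suc (2 * jac (2 * suc k))                               ∎
    where
    open ≡-Reasoning
    regroup : ∀ x y → x + (y + y) ≡ x + 2 * y
    regroup = solve-∀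
    double : ∀ x → x + suc x ≡ suc (2 * x)
    double = solve-∀

  jac-odd-step k = begin
    suc (jac (suc (2 * k)) + (jac (2 * k) + jac (2 * k))) ≡⟨ regroup (jac (suc (2 * k))) (jac (2 * k)) ⟩
    jac (suc (2 * k)) + suc (2 * jac (2 * k))             ≡⟨ cong (jac (suc (2 * k)) +_) (jac-even-step k) ⟨
    jac (suc (2 * k)) + jac (suc (2 * k))                 ≡⟨ cong (jac (suc (2 * k)) +_) (+-identityʳ _) ⟨
    2 * jac (suc (2 * k))                                 ∎
    where
    open ≡-Reasoning
    regroup : ∀ x y → suc (x + (y + y)) ≡ x + suc (2 * y)
    regroup = solve-∀

  private
    a-jac-step : ∀ n → a (jac n) ≡ fib n → a (jac (suc n)) ≡ fib (suc n) → a (jac (2 + n)) ≡ fib (2 + n)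
    a-jac-step n ih₀ ih₁ with even-or-odd n
    ... | inj₁ (k , refl) = begin
      a (J₁ + (J₀ + J₀))                   ≡⟨ cong (λ j → a (j + (J₀ + J₀))) (jac-even-step k) ⟩
      a (suc (2 * J₀) + (J₀ + J₀))         ≡⟨ cong a (regroup J₀) ⟩
      a (suc (2 * (2 * J₀)))               ≡⟨ a-double+1 (2 * J₀) ⟩
      a (2 * J₀) + a (suc (2 * J₀))        ≡⟨ cong₂ _+_ (a-double J₀) (cong a (sym (jac-even-step k))) ⟩
      a J₀ + a J₁                          ≡⟨ cong₂ _+_ ih₀ ih₁ ⟩
      fib (2 * k) + fib (suc (2 * k))      ≡⟨ +-comm (fib (2 * k)) _ ⟩
      fib (2 + 2 * k)                      ∎
      where
      open ≡-Reasoning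
      J₀ = jac (2 * k)
      J₁ = jac (suc (2 * k))
      regroup : ∀ x → suc (2 * x) + (x + x) ≡ suc (2 * (2 * x))
      regroup = solve-∀
    ... | inj₂ (k , refl) = begin
      a (J₂ + (J₁ + J₁))                   ≡⟨ cong (λ j → a (J₂ + j)) (two J₁) ⟩
      a (J₂ + 2 * J₁)                      ≡⟨ cong (λ j → a (J₂ + j)) (jac-odd-step k) ⟨
      a (J₂ + suc J₂)                      ≡⟨ cong a (regroup J₂) ⟩
      a (suc (2 * J₂))                     ≡⟨ a-double+1 J₂ ⟩
      a J₂ + a (suc J₂)                    ≡⟨ cong (λ j → a J₂ + a j) (jac-odd-step k) ⟩
      a J₂ + a (2 * J₁)                    ≡⟨ cong (a J₂ +_) (a-double J₁) ⟩
      a J₂ + a J₁                          ≡⟨ cong₂ _+_ ih₁ ih₀ ⟩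
      fib (3 + 2 * k)                      ∎
      where
      open ≡-Reasoning
      J₁ = jac (suc (2 * k))
      J₂ = jac (2 + 2 * k)
      regroup : ∀ x → x + suc x ≡ suc (2 * x)
      regroup = solve-∀
      two : ∀ x → x + x ≡ 2 * x
      two = solve-∀

  a-jac : ∀ n → a (jac n) ≡ fib n
  a-jac 0             = refl
  a-jac 1             = refl
  a-jac (suc (suc n)) = a-jac-step n (a-jac n) (a-jac (suc n))

  mSeq≡jac : ∀ n → mSeq n ≡ jac n
  mSeq≡jac n with even-or-odd n
  ... | inj₁ (k , refl) rewrite 2*n%2≡0 k = begin
    (2 ^ (2 * k) ∸ 1) / 3                            ≡⟨ cong (λ x → (x ∸ 1) / 3) (2^n≡jac[n]+jac[1+n] (2 * k)) ⟩
    (jac (2 * k) + jac (suc (2 * k)) ∸ 1) / 3        ≡⟨ cong (λ x → (jac (2 * k) + x ∸ 1) / 3) (jac-even-step k) ⟩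
    (jac (2 * k) + suc (2 * jac (2 * k)) ∸ 1) / 3    ≡⟨ cong (λ x → (x ∸ 1) / 3) (regroup (jac (2 * k))) ⟩
    (jac (2 * k) * 3 + 1 ∸ 1) / 3                    ≡⟨ cong (_/ 3) (m+n∸n≡m (jac (2 * k) * 3) 1) ⟩
    jac (2 * k) * 3 / 3                              ≡⟨ m*n/n≡m (jac (2 * k)) 3 ⟩
    jac (2 * k)                                      ∎
    where
    open ≡-Reasoning
    regroup : ∀ x → x + suc (2 * x) ≡ x * 3 + 1
    regroup = solve-∀
  ... | inj₂ (k , refl) rewrite [1+2*n]%2≡1 k = begin
    (2 ^ suc (2 * k) + 1) / 3                        ≡⟨ cong (λ x → (x + 1) / 3) (2^n≡jac[n]+jac[1+n] (suc (2 * k))) ⟩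
    (jac (suc (2 * k)) + jac (2 + 2 * k) + 1) / 3    ≡⟨ cong (_/ 3) (+-assoc (jac (suc (2 * k))) _ 1) ⟩
    (jac (suc (2 * k)) + (jac (2 + 2 * k) + 1)) / 3  ≡⟨ cong (λ x → (jac (suc (2 * k)) + x) / 3) (+-comm _ 1) ⟩
    (jac (suc (2 * k)) + suc (jac (2 + 2 * k))) / 3  ≡⟨ cong (λ x → (jac (suc (2 * k)) + x) / 3) (jac-odd-step k) ⟩
    (jac (suc (2 * k)) + 2 * jac (suc (2 * k))) / 3  ≡⟨ cong (_/ 3) (regroup (jac (suc (2 * k)))) ⟩
    jac (suc (2 * k)) * 3 / 3                        ≡⟨ m*n/n≡m (jac (suc (2 * k))) 3 ⟩
    jac (suc (2 * k))                                ∎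
    where
    open ≡-Reasoning
    regroup : ∀ x → x + 2 * x ≡ x * 3
    regroup = solve-∀

  jac-step-mono : ∀ n → jac n ≤ jac (suc n)
  jac-step-mono 0       = z≤n
  jac-step-mono (suc n) = m≤m+n (jac (suc n)) (jac n + jac n)

  jac-mono-≤ : ∀ {m n} → m ≤ n → jac m ≤ jac n
  jac-mono-≤ m≤n = go (≤⇒≤′ m≤n)
    where
    go : ∀ {m n} → m ≤′ n → jac m ≤ jac n
    go ≤′-refl       = ≤-refl
    go (≤′-step {n} m≤n) = ≤-trans (go m≤n) (jac-step-mono n)

  fib/jac-antitone : ∀ n → fib (suc n) * jac n ≤ fib n * jac (suc n)
  fib/jac-antitone 0             = z≤n
  fib/jac-antitone 1             = ≤-refl
  fib/jac-antitone (suc (suc n)) = begin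
    fib (3 + n) * jac (2 + n)                 ≡⟨ lhs (fib (suc n)) (fib n) (jac (suc n)) (jac n) ⟩
    X + 2 * (fib (1 + n) * jac n)             ≤⟨ +-monoʳ-≤ X (*-monoʳ-≤ 2 (fib/jac-antitone n)) ⟩
    X + 2 * (fib n * jac (1 + n))             ≤⟨ +-monoʳ-≤ X (m≤m+n _ _) ⟩
    X + (2 * (fib n * jac (1 + n)) + Y)       ≡⟨ rhs (fib (suc n)) (fib n) (jac (suc n)) (jac n) ⟩
    fib (2 + n) * jac (3 + n)                 ∎
    where
    open ≤-Reasoning
    Y = fib (1 + n) * jac (1 + n)
    X = fib (2 + n) * jac (2 + n) + Y
    lhs : ∀ f₁ f₀ j₁ j₀ → ((f₁ + f₀) + f₁) * (j₁ + (j₀ + j₀)) ≡ (f₁ + f₀) * (j₁ + (j₀ + j₀)) + f₁ * j₁ + 2 * (f₁ * j₀)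
    lhs = solve-∀
    rhs : ∀ f₁ f₀ j₁ j₀ → (f₁ + f₀) * (j₁ + (j₀ + j₀)) + f₁ * j₁ + (2 * (f₀ * j₁) + f₁ * j₁)
                          ≡ (f₁ + f₀) * ((j₁ + (j₀ + j₀)) + (j₁ + j₁))
    rhs = solve-∀

  jac-strict : ∀ n → jac (2 + n) < jac (3 + n)
  jac-strict n = m<m+n (jac (2 + n)) (≤-trans (jac-mono-≤ {1} {suc n} (s≤s z≤n)) (m≤m+n (jac (suc n)) (jac (suc n))))

  n≤jac[2+n] : ∀ n → n ≤ jac (2 + n)
  n≤jac[2+n] zero    = z≤n
  n≤jac[2+n] (suc n) = ≤-trans (s≤s (n≤jac[2+n] n)) (jac-strict n)

  fib-pos : ∀ n → 0 < fib (suc n)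
  fib-pos zero    = s≤s z≤n
  fib-pos (suc n) = ≤-trans (fib-pos n) (m≤m+n (fib (suc n)) (fib n))

module Chords where
  import Data.Nat.Base as ℕ
  open ℕ using (ℕ; zero; suc; z≤n; s≤s)
  import Data.Nat.Properties as ℕ-Props
  open import Data.Integer.Base hiding (suc)
  open import Data.Integer.Properties
  open import Data.Integer.Tactic.RingSolver using (solve; solve-∀)
  open import Data.List.Base using ([]; _∷_)
  open import Data.Sum.Base using (inj₁; inj₂)
  open import Relation.Binary.PropositionalEquality hiding (J)

  open FibonacciJacobsthal

  private
    *-monoˡ-≤-0≤ : ∀ {c i j} → 0ℤ ≤ c → i ≤ j → c * i ≤ c * j
    *-monoˡ-≤-0≤ {c} 0≤c = *-monoˡ-≤-nonNeg c {{nonNegative 0≤c}}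

    *-cancelˡ-≤-0< : ∀ {c i j} → 0ℤ < c → c * i ≤ c * j → i ≤ j
    *-cancelˡ-≤-0< {c} {i} {j} 0<c = *-cancelˡ-≤-pos i j c {{positive 0<c}}

    *-cancelʳ-≤-0< : ∀ {c i j} → 0ℤ < c → i * c ≤ j * c → i ≤ j
    *-cancelʳ-≤-0< {c} {i} {j} 0<c = *-cancelʳ-≤-pos i j c {{positive 0<c}}

    0≤+ : ∀ n → 0ℤ ≤ + n
    0≤+ n = +≤+ z≤n

    0≤* : ∀ {i j} → 0ℤ ≤ i → 0ℤ ≤ j → 0ℤ ≤ i * j
    0≤* {i} {j} 0≤i 0≤j = subst (_≤ i * j) (*-zeroʳ i) (*-monoˡ-≤-0≤ 0≤i 0≤j)

  BelowLine : (D S X Y x y : ℤ) → Set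
  BelowLine D S X Y x y = y * D ≤ Y * D + (x - X) * S

  belowLine-rotate : ∀ {D S D′ S′ X Y x y} → 0ℤ < D → 0ℤ ≤ D′ →
    (x - X) * (S * D′) ≤ (x - X) * (S′ * D) → BelowLine D S X Y x y → BelowLine D′ S′ X Y x y
  belowLine-rotate {D} {S} {D′} {S′} {X} {Y} {x} {y} 0<D 0≤D′ turn below = *-cancelˡ-≤-0< 0<D (begin
    D * (y * D′)                               ≡⟨ solve (D ∷ D′ ∷ y ∷ []) ⟩
    D′ * (y * D)                               ≤⟨ *-monoˡ-≤-0≤ 0≤D′ below ⟩
    D′ * (Y * D + (x - X) * S)                 ≡⟨ solve (D ∷ D′ ∷ S ∷ X ∷ Y ∷ x ∷ []) ⟩
    D * (Y * D′) + (x - X) * (S * D′)          ≤⟨ +-monoʳ-≤ (D * (Y * D′)) turn ⟩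
    D * (Y * D′) + (x - X) * (S′ * D)          ≡⟨ solve (D ∷ D′ ∷ S′ ∷ X ∷ Y ∷ x ∷ []) ⟩
    D * (Y * D′ + (x - X) * S′)                ∎)
    where open ≤-Reasoning

  ratio-≤-trans : ∀ {A a B b C c} → 0ℤ < b → 0ℤ ≤ a → 0ℤ ≤ c →
    A * b ≤ B * a → B * c ≤ C * b → A * c ≤ C * a
  ratio-≤-trans {A} {a} {B} {b} {C} {c} 0<b 0≤a 0≤c A/a≤B/b B/b≤C/c = *-cancelˡ-≤-0< 0<b (begin
    b * (A * c)     ≡⟨ solve (A ∷ b ∷ c ∷ []) ⟩
    c * (A * b)     ≤⟨ *-monoˡ-≤-0≤ 0≤c A/a≤B/b ⟩
    c * (B * a)     ≡⟨ solve (B ∷ a ∷ c ∷ []) ⟩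
    a * (B * c)     ≤⟨ *-monoˡ-≤-0≤ 0≤a B/b≤C/c ⟩
    a * (C * b)     ≡⟨ solve (C ∷ a ∷ b ∷ []) ⟩
    b * (C * a)     ∎)
    where open ≤-Reasoning

  F J : ℕ → ℤ
  F n = + fib n
  J n = + jac n

  pos-∸ : ∀ {m n} → n ℕ.≤ m → + (m ℕ.∸ n) ≡ + m - + n
  pos-∸ {m} {n} n≤m = trans (sym (⊖-≥ n≤m)) (sym (m-n≡m⊖n m n))

  run rise : ℕ → ℤ
  run  n = J (suc n) - J n
  rise n = F (suc n) - F n

  -- run n times the line through (J n , F n) and (J (1 + n) , F (1 + n)); on [J n , J (1 + n)] this line is h.
  chord : ℕ → ℤ → ℤ
  chord n x = F n * run n + (x - J n) * rise n

  BelowChord : ℕ → ℤ → ℤ → Set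
  BelowChord n = BelowLine (run n) (rise n) (J n) (F n)

  rise-suc : ∀ n → rise (suc n) ≡ F n
  rise-suc n = cancel (F (suc n)) (F n)
    where
    cancel : ∀ x y → (x + y) - x ≡ y
    cancel = solve-∀

  run-suc : ∀ n → run (suc n) ≡ + 2 * J n
  run-suc n = cancel (J (suc n)) (J n)
    where
    cancel : ∀ x y → (x + (y + y)) - x ≡ + 2 * y
    cancel = solve-∀

  rise-nonneg : ∀ n → 0ℤ ≤ rise n
  rise-nonneg zero    = +≤+ z≤n
  rise-nonneg (suc n) = subst (0ℤ ≤_) (sym (rise-suc n)) (0≤+ (fib n))

  run-nonneg : ∀ n → 0ℤ ≤ run n
  run-nonneg zero    = +≤+ z≤n
  run-nonneg (suc n) = subst (0ℤ ≤_) (sym (run-suc n)) (0≤* (0≤+ 2) (0≤+ (jac n)))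

  run-positive : ∀ {n} → 2 ℕ.≤ n → 0ℤ < run n
  run-positive {suc (suc n)} (s≤s (s≤s _)) = subst (0ℤ <_) (trans (pos-* 2 (jac (suc n))) (sym (run-suc (suc n))))
    (+<+ (ℕ-Props.≤-trans (jac-mono-≤ {1} {suc n} (s≤s z≤n)) (ℕ-Props.m≤m+n (jac (suc n)) (1 ℕ.* jac (suc n)))))

  slope-antitone : ∀ n → rise (suc n) * run n ≤ rise n * run (suc n)
  slope-antitone zero    = +≤+ z≤n
  slope-antitone (suc n) = begin
    rise (suc (suc n)) * run (suc n)   ≡⟨ cong₂ _*_ (rise-suc (suc n)) (run-suc n) ⟩
    F (suc n) * (+ 2 * J n)            ≡⟨ swap (F (suc n)) (J n) ⟩
    + 2 * (F (suc n) * J n)            ≤⟨ *-monoˡ-≤-0≤ (0≤+ 2) (cast (fib/jac-antitone n)) ⟩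
    + 2 * (F n * J (suc n))            ≡⟨ swap (F n) (J (suc n)) ⟨
    F n * (+ 2 * J (suc n))            ≡⟨ cong₂ _*_ (rise-suc n) (run-suc (suc n)) ⟨
    rise (suc n) * run (suc (suc n))   ∎
    where
    open ≤-Reasoning
    swap : ∀ x y → x * (+ 2 * y) ≡ + 2 * (x * y)
    swap = solve-∀
    cast : fib (suc n) ℕ.* jac n ℕ.≤ fib n ℕ.* jac (suc n) → F (suc n) * J n ≤ F n * J (suc n)
    cast le = subst₂ _≤_ (pos-* (fib (suc n)) (jac n)) (pos-* (fib n) (jac (suc n))) (+≤+ le)

  private
    chord-step : ∀ n x → chord n x * run (suc n) - chord (suc n) x * run n
                         ≡ (x - J (suc n)) * (rise n * run (suc n) - rise (suc n) * run n)
    chord-step n x = identity (F n) (F (suc n)) (F (suc (suc n))) (J n) (J (suc n)) (J (suc (suc n))) x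
      where
      identity : ∀ f₀ f₁ f₂ j₀ j₁ j₂ x →
        (f₀ * (j₁ - j₀) + (x - j₀) * (f₁ - f₀)) * (j₂ - j₁) - (f₁ * (j₂ - j₁) + (x - j₁) * (f₂ - f₁)) * (j₁ - j₀)
        ≡ (x - j₁) * ((f₁ - f₀) * (j₂ - j₁) - (f₂ - f₁) * (j₁ - j₀))
      identity = solve-∀

    slope-gap-nonneg : ∀ n → NonNegative (rise n * run (suc n) - rise (suc n) * run n)
    slope-gap-nonneg n = nonNegative (i≤j⇒0≤j-i (slope-antitone n))

    chord-stepˡ : ∀ n {x} → x ≤ J (suc n) → chord n x * run (suc n) ≤ chord (suc n) x * run n
    chord-stepˡ n {x} x≤J = i-j≤0⇒i≤j (subst (_≤ 0ℤ) (sym (chord-step n x))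
      (*-monoʳ-≤-nonNeg _ {{slope-gap-nonneg n}} (i≤j⇒i-j≤0 x≤J)))

    chord-stepʳ : ∀ n {x} → J (suc n) ≤ x → chord (suc n) x * run n ≤ chord n x * run (suc n)
    chord-stepʳ n {x} J≤x = 0≤i-j⇒j≤i (subst (0ℤ ≤_) (sym (chord-step n x))
      (*-monoʳ-≤-nonNeg _ {{slope-gap-nonneg n}} (i≤j⇒0≤j-i J≤x)))

  -- Concavity: on [J n , J (1 + n)] chord n is the lowest of all chords.
  chord-minimalʳ : ∀ {n p x} → 2 ℕ.≤ n → n ℕ.≤′ p → x ≤ J (suc n) → chord n x * run p ≤ chord p x * run n
  chord-minimalʳ _   ℕ.≤′-refl                x≤J = ≤-refl
  chord-minimalʳ {n} {suc p} {x} 2≤n (ℕ.≤′-step n≤p) x≤J =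
    ratio-≤-trans {chord n x} {B = chord p x} {C = chord (suc p) x}
      (run-positive (ℕ-Props.≤-trans 2≤n n≤p′)) (run-nonneg n) (run-nonneg (suc p))
      (chord-minimalʳ 2≤n n≤p x≤J) (chord-stepˡ p (≤-trans x≤J (+≤+ (jac-mono-≤ (s≤s n≤p′)))))
    where
    n≤p′ : n ℕ.≤ p
    n≤p′ = ℕ-Props.≤′⇒≤ n≤p

  chord-minimalˡ : ∀ {n p x} → 2 ℕ.≤ p → p ℕ.≤′ n → J n ≤ x → chord n x * run p ≤ chord p x * run n
  chord-minimalˡ _   ℕ.≤′-refl                J≤x = ≤-refl
  chord-minimalˡ {suc n} {p} {x} 2≤p (ℕ.≤′-step p≤n) J≤x =
    ratio-≤-trans {chord (suc n) x} {B = chord n x} {C = chord p x}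
      (run-positive (ℕ-Props.≤-trans 2≤p p≤n′)) (run-nonneg (suc n)) (run-nonneg p)
      (chord-stepʳ n J≤x) (chord-minimalˡ 2≤p p≤n (≤-trans (+≤+ (jac-step-mono n)) J≤x))
    where
    p≤n′ : p ℕ.≤ n
    p≤n′ = ℕ-Props.≤′⇒≤ p≤n

  belowChord-compare : ∀ {n p x y} → 0ℤ < run n → 0ℤ ≤ run p →
    chord n x * run p ≤ chord p x * run n → BelowChord n x y → BelowChord p x y
  belowChord-compare {n} {p} {x} {y} 0<jac[1+n]∸jac[n] 0≤run cmp below =
    *-cancelˡ-≤-0< 0<jac[1+n]∸jac[n] (begin
      run n * (y * run p)      ≡⟨ swap (run n) y (run p) ⟩
      run p * (y * run n)      ≤⟨ *-monoˡ-≤-0≤ 0≤run below ⟩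
      run p * chord n x        ≡⟨ *-comm (run p) (chord n x) ⟩
      chord n x * run p        ≤⟨ cmp ⟩
      chord p x * run n        ≡⟨ *-comm (chord p x) (run n) ⟩
      run n * chord p x        ∎)
    where
    open ≤-Reasoning
    swap : ∀ a b c → a * (b * c) ≡ c * (b * a)
    swap = solve-∀

  belowChord-transfer : ∀ {n p x y} → 2 ℕ.≤ n → 2 ℕ.≤ p → J n ≤ x → x ≤ J (suc n) →
    BelowChord n x y → BelowChord p x y
  belowChord-transfer {n} {p} {x} {y} 2≤n 2≤p J≤x x≤J with ℕ-Props.≤-total n p
  ... | inj₁ n≤p = belowChord-compare {n} {p} {x} {y} (run-positive 2≤n) (run-nonneg p)
                     (chord-minimalʳ 2≤n (ℕ-Props.≤⇒≤′ n≤p) x≤J)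
  ... | inj₂ p≤n = belowChord-compare {n} {p} {x} {y} (run-positive 2≤n) (run-nonneg p)
                     (chord-minimalˡ 2≤p (ℕ-Props.≤⇒≤′ p≤n) J≤x)

  chord-anchorʳ : ∀ n x → F (suc n) * run n + (x - J (suc n)) * rise n ≡ chord n x
  chord-anchorʳ n x = identity (F n) (F (suc n)) (J n) (J (suc n)) x
    where
    identity : ∀ f₀ f₁ j₀ j₁ x → f₁ * (j₁ - j₀) + (x - j₁) * (f₁ - f₀) ≡ f₀ * (j₁ - j₀) + (x - j₀) * (f₁ - f₀)
    identity = solve-∀

  belowChord-node : ∀ {n x y} → 2 ℕ.≤ n → J n ≤ x → y ≤ F n → BelowChord n x y
  belowChord-node {n} {x} {y} 2≤n J≤x y≤F = begin
    y * run n                      ≤⟨ *-monoʳ-≤-nonNeg (run n) {{nonNegative (run-nonneg n)}} y≤F ⟩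
    F n * run n                    ≡⟨ +-identityʳ (F n * run n) ⟨
    F n * run n + 0ℤ               ≤⟨ +-monoʳ-≤ (F n * run n) (0≤* (i≤j⇒0≤j-i J≤x) (rise-nonneg n)) ⟩
    F n * run n + (x - J n) * rise n ∎
    where open ≤-Reasoning

  -- chord r at c and at 2^r − c = (J r + J (1 + r)) − c sums to 2 F r + rise r = F (2 + r), whatever c is.
  belowChord-mirror-sum : ∀ r {c w y₁ y₂} → 2 ℕ.≤ r → w ≡ (J r + J (suc r)) - c →
    BelowChord r c y₁ → BelowChord r w y₂ → y₁ + y₂ ≤ F (2 ℕ.+ r)
  belowChord-mirror-sum r {c} {y₁ = y₁} {y₂} 2≤r refl below₁ below₂ = *-cancelʳ-≤-0< (run-positive 2≤r) (begin
    (y₁ + y₂) * run r             ≡⟨ *-distribʳ-+ (run r) y₁ y₂ ⟩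
    y₁ * run r + y₂ * run r       ≤⟨ +-mono-≤ below₁ below₂ ⟩
    chord r c + chord r ((J r + J (suc r)) - c)
                                  ≡⟨ identity (F r) (F (suc r)) (J r) (J (suc r)) c ⟩
    F (2 ℕ.+ r) * run r           ∎)
    where
    open ≤-Reasoning
    identity : ∀ f₀ f₁ j₀ j₁ c →
      (f₀ * (j₁ - j₀) + (c - j₀) * (f₁ - f₀)) + (f₀ * (j₁ - j₀) + (((j₀ + j₁) - c) - j₀) * (f₁ - f₀))
      ≡ (f₁ + f₀) * (j₁ - j₀)
    identity = solve-∀

  slope-antitone₂ : ∀ {p} → 1 ℕ.≤ p → rise (2 ℕ.+ p) * run p ≤ rise p * run (2 ℕ.+ p)
  slope-antitone₂ {p} 1≤p =
    ratio-≤-trans {rise (2 ℕ.+ p)} {run (2 ℕ.+ p)} {rise (suc p)} {run (suc p)} {rise p} {run p}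
      (run-positive (s≤s 1≤p)) (run-nonneg (2 ℕ.+ p)) (run-nonneg p) (slope-antitone (suc p)) (slope-antitone p)

  -- With u = 2^p − c and m = 2^(1+p) + c, chord p at u plus twice chord p at c is the line through
  -- (J (3 + p) , F (3 + p)) of slope rise p / run p; left of J (3 + p) it lies below the flatter chord (2 + p).
  belowChord-y₁+2y₂ : ∀ p {u c m y₁ y₂} → 2 ℕ.≤ p → u ≡ (J p + J (suc p)) - c → m ≡ (J (suc p) + J (2 ℕ.+ p)) + c →
    c ≤ J (suc p) → BelowChord p u y₁ → BelowChord p c y₂ → BelowChord (2 ℕ.+ p) m (y₁ + + 2 * y₂)
  belowChord-y₁+2y₂ p {c = c} {y₁ = y₁} {y₂} 2≤p refl refl c≤J below₁ below₂ =
    subst (_ ≤_) (chord-anchorʳ (2 ℕ.+ p) m)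
      (belowLine-rotate {S = rise p} {S′ = rise (2 ℕ.+ p)} {J (3 ℕ.+ p)} {F (3 ℕ.+ p)} {m} {y₁ + + 2 * y₂}
        (run-positive 2≤p) (run-nonneg (2 ℕ.+ p)) turn line)
    where
    m = (J (suc p) + J (2 ℕ.+ p)) + c
    line : BelowLine (run p) (rise p) (J (3 ℕ.+ p)) (F (3 ℕ.+ p)) m (y₁ + + 2 * y₂)
    line = begin
      (y₁ + + 2 * y₂) * run p                             ≡⟨ distrib y₁ y₂ (run p) ⟩
      y₁ * run p + + 2 * (y₂ * run p)                     ≤⟨ +-mono-≤ below₁ (*-monoˡ-≤-0≤ (0≤+ 2) below₂) ⟩
      chord p ((J p + J (suc p)) - c) + + 2 * chord p c   ≡⟨ identity (F p) (F (suc p)) (J p) (J (suc p)) c ⟩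
      F (3 ℕ.+ p) * run p + (m - J (3 ℕ.+ p)) * rise p    ∎
      where
      open ≤-Reasoning
      identity : ∀ f₀ f₁ j₀ j₁ c →
        (f₀ * (j₁ - j₀) + (((j₀ + j₁) - c) - j₀) * (f₁ - f₀)) + + 2 * (f₀ * (j₁ - j₀) + (c - j₀) * (f₁ - f₀))
        ≡ ((f₁ + f₀) + f₁) * (j₁ - j₀) + (((j₁ + (j₁ + (j₀ + j₀))) + c) - ((j₁ + (j₀ + j₀)) + (j₁ + j₁))) * (f₁ - f₀)
      identity = solve-∀
      distrib : ∀ y₁ y₂ d → (y₁ + + 2 * y₂) * d ≡ y₁ * d + + 2 * (y₂ * d)
      distrib = solve-∀
    turn : (m - J (3 ℕ.+ p)) * (rise p * run (2 ℕ.+ p)) ≤ (m - J (3 ℕ.+ p)) * (rise (2 ℕ.+ p) * run p)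
    turn = *-monoˡ-≤-nonPos (m - J (3 ℕ.+ p)) {{nonPositive m≤J}} (slope-antitone₂ (ℕ-Props.≤-trans (s≤s z≤n) 2≤p))
      where
      m≤J : m - J (3 ℕ.+ p) ≤ 0ℤ
      m≤J = subst (_≤ 0ℤ) (sym (identity (J p) (J (suc p)) c)) (i≤j⇒i-j≤0 c≤J)
        where
        identity : ∀ j₀ j₁ c → ((j₁ + (j₁ + (j₀ + j₀))) + c) - ((j₁ + (j₀ + j₀)) + (j₁ + j₁)) ≡ c - j₁
        identity = solve-∀

module UpperBound where
  open import Data.Fin.Base using (Fin; toℕ; fromℕ<)
  open import Data.Fin.Properties using (all?; toℕ-fromℕ<)
  open import Data.Integer.Base as ℤ using (+_; +≤+)
  import Data.Integer.Properties as ℤ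
  open import Data.Nat.Base
  open import Data.Nat.Induction using (<-Rec; <-rec)
  open import Data.Nat.Properties
  open import Data.Nat.Tactic.RingSolver using (solve-∀)
  open import Data.Product.Base using (∃₂; _×_; _,_)
  open import Relation.Binary.PropositionalEquality hiding (J)
  open import Relation.Nullary.Decidable using (yes; no; toWitness; _×-dec_)
  open import Relation.Nullary.Negation using (contradiction)

  open import Defs using (a; seg)
  open SternSequence
  open FibonacciJacobsthal
  open Chords

  BelowAllChords : ℕ → Set
  BelowAllChords m = ∀ p → 2 ≤ p → BelowChord p (+ m) (+ a m)

  belowAllChords-0 : BelowAllChords 0
  belowAllChords-0 p 2≤p = belowChord-compare {2} {p} {+ 0} {+ 0} (run-positive ≤-refl) (run-nonneg p)
    (chord-minimalʳ ≤-refl (≤⇒≤′ 2≤p) (+≤+ z≤n)) (+≤+ z≤n)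

  private
    BelowOwnChord : ℕ → Set
    BelowOwnChord m = let n = seg m in 2 ≤ n × jac n ≤ m × m ≤ jac (suc n) × BelowChord n (+ m) (+ a m)

    belowOwnChord : ∀ (i : Fin 7) → BelowOwnChord (suc (toℕ i))
    belowOwnChord = toWitness {a? = all? λ i → let m = suc (toℕ i); n = seg m in
      2 ≤? n ×-dec jac n ≤? m ×-dec m ≤? jac (suc n) ×-dec + a m ℤ.* run n ℤ.≤? chord n (+ m)} _

  -- The induction step uses chord (r − 1) for m ∈ [2^r , 2^(1+r)), which needs r ≥ 3.
  belowAllChords-small : ∀ m → m < 8 → BelowAllChords m
  belowAllChords-small zero    _         = belowAllChords-0
  belowAllChords-small (suc i) (s≤s i<7) p 2≤p
    with subst BelowOwnChord (cong suc (toℕ-fromℕ< i<7)) (belowOwnChord (fromℕ< i<7))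
  ... | 2≤n , lo , hi , below = belowChord-transfer {y = + a (suc i)} 2≤n 2≤p (+≤+ lo) (+≤+ hi) below

  leading-power-of-two : ∀ m → 1 ≤ m → ∃₂ λ r c → m ≡ 2 ^ r + c × c < 2 ^ r
  leading-power-of-two (suc zero)    _ = 0 , 0 , refl , s≤s z≤n
  leading-power-of-two (suc (suc m)) _ with leading-power-of-two (suc m) (s≤s z≤n)
  ... | r , c , m+1≡2^r+c , c<2^r with suc c <? 2 ^ r
  ...   | yes c+1<2^r = r , suc c , trans (cong suc m+1≡2^r+c) (sym (+-suc (2 ^ r) c)) , c+1<2^r
  ...   | no  c+1≮2^r = suc r , 0 , trans (cong suc m+1≡2^r+c) eq , m^n>0 2 (suc r)
    where
    eq : suc (2 ^ r + c) ≡ 2 ^ suc r + 0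
    eq = begin
      suc (2 ^ r + c)   ≡⟨ +-suc (2 ^ r) c ⟨
      2 ^ r + suc c     ≡⟨ cong (λ k → 2 ^ r + k) (≤-antisym c<2^r (≮⇒≥ c+1≮2^r)) ⟩
      2 ^ r + 2 ^ r     ≡⟨ double (2 ^ r) ⟩
      2 ^ suc r + 0     ∎
      where
      open ≡-Reasoning
      double : ∀ x → x + x ≡ 2 * x + 0
      double = solve-∀

  private
    pos-2^n : ∀ n → + (2 ^ n) ≡ J n ℤ.+ J (suc n)
    pos-2^n n = cong +_ (2^n≡jac[n]+jac[1+n] n)

  -- On [2^(3+n) , J (5+n)], a m = a (2^(2+n) − c) + 2 a c is bounded through chord (2+n).
  belowAllChords-rising : ∀ n {c} → c ≤ jac (3 + n) →
    <-Rec BelowAllChords (2 ^ (3 + n) + c) → BelowAllChords (2 ^ (3 + n) + c)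
  belowAllChords-rising n {c} c≤J IH p 2≤p =
    subst (BelowChord p (+ m)) a[m]≡
      (belowChord-transfer {4 + n} {p} {y = + a u ℤ.+ + 2 ℤ.* + a c} (s≤s (s≤s z≤n)) 2≤p lo hi below)
    where
    m = 2 ^ (3 + n) + c
    c≤2^[2+n] : c ≤ 2 ^ (2 + n)
    c≤2^[2+n] = ≤-trans c≤J (jac[1+n]≤2^n (2 + n))
    u = 2 ^ (2 + n) ∸ c
    u<m : u < m
    u<m = ≤-<-trans (m∸n≤m _ c) (<-≤-trans (^-monoʳ-< 2 (s≤s (s≤s z≤n)) (n<1+n (2 + n))) (m≤m+n _ c))
    a[m]≡ : + a u ℤ.+ + 2 ℤ.* + a c ≡ + a m
    a[m]≡ = trans (cong (λ z → + a u ℤ.+ z) (sym (ℤ.pos-* 2 (a c)))) (cong +_ (sym (a-2^[1+j]+c (2 + n) c≤2^[2+n])))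
    below : BelowChord (4 + n) (+ m) (+ a u ℤ.+ + 2 ℤ.* + a c)
    below = belowChord-y₁+2y₂ (2 + n) {y₁ = + a u} {+ a c} (s≤s (s≤s z≤n))
      (trans (pos-∸ c≤2^[2+n]) (cong (ℤ._- + c) (pos-2^n (2 + n)))) (cong (ℤ._+ + c) (pos-2^n (3 + n))) (+≤+ c≤J)
      (IH u<m (2 + n) (s≤s (s≤s z≤n))) (IH (m<n+m c (m^n>0 2 (3 + n))) (2 + n) (s≤s (s≤s z≤n)))
    lo : J (4 + n) ℤ.≤ + m
    lo = +≤+ (≤-trans (jac[1+n]≤2^n (3 + n)) (m≤m+n _ c))
    hi : + m ℤ.≤ J (5 + n)
    hi = +≤+ (≤-trans (+-monoʳ-≤ (2 ^ (3 + n)) c≤J) (≤-reflexive (2^n+jac[n]≡jac[2+n] (3 + n))))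

  -- On [J (5+n) , 2^(4+n)), a m = a c + a (2^(3+n) − c) ≤ F (5+n) = h (J (5+n)) ≤ h m.
  belowAllChords-falling : ∀ n {c} → jac (3 + n) ≤ c → c < 2 ^ (3 + n) →
    <-Rec BelowAllChords (2 ^ (3 + n) + c) → BelowAllChords (2 ^ (3 + n) + c)
  belowAllChords-falling n {c} J≤c c<2^[3+n] IH p 2≤p =
    subst (BelowChord p (+ m)) a[m]≡
      (belowChord-transfer {5 + n} {p} {y = + a c ℤ.+ + a w} (s≤s (s≤s z≤n)) 2≤p lo hi below)
    where
    m = 2 ^ (3 + n) + c
    c≤2^[3+n] : c ≤ 2 ^ (3 + n)
    c≤2^[3+n] = <⇒≤ c<2^[3+n]
    w = 2 ^ (3 + n) ∸ c
    w<m : w < m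
    w<m = <-≤-trans (∸-monoʳ-< (≤-trans (jac-mono-≤ {1} {3 + n} (s≤s z≤n)) J≤c) c≤2^[3+n]) (m≤m+n _ c)
    a[m]≡ : + a c ℤ.+ + a w ≡ + a m
    a[m]≡ = cong +_ (trans (+-comm (a c) (a w)) (sym (a-2^j+c (3 + n) c≤2^[3+n])))
    lo : J (5 + n) ℤ.≤ + m
    lo = +≤+ (≤-trans (≤-reflexive (sym (2^n+jac[n]≡jac[2+n] (3 + n)))) (+-monoʳ-≤ (2 ^ (3 + n)) J≤c))
    hi : + m ℤ.≤ J (6 + n)
    hi = +≤+ (≤-trans (+-monoʳ-≤ (2 ^ (3 + n)) (≤-trans c≤2^[3+n] (≤-reflexive (sym (+-identityʳ _)))))
                      (2^n≤jac[2+n] (4 + n)))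
    below : BelowChord (5 + n) (+ m) (+ a c ℤ.+ + a w)
    below = belowChord-node {5 + n} (s≤s (s≤s z≤n)) lo
      (belowChord-mirror-sum (3 + n) {+ c} {+ w} {+ a c} {+ a w} (s≤s (s≤s z≤n))
        (trans (pos-∸ c≤2^[3+n]) (cong (ℤ._- + c) (pos-2^n (3 + n))))
        (IH (m<n+m c (m^n>0 2 (3 + n))) (3 + n) (s≤s (s≤s z≤n))) (IH w<m (3 + n) (s≤s (s≤s z≤n))))

  belowAllChords : ∀ m → BelowAllChords m
  belowAllChords = <-rec BelowAllChords step
    where
    step : ∀ m → <-Rec BelowAllChords m → BelowAllChords m
    step m IH with m <? 8
    ... | yes m<8 = belowAllChords-small m m<8
    ... | no m≮8 with leading-power-of-two m (≤-trans (s≤s z≤n) (≮⇒≥ m≮8))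
    ...   | r , c , refl , c<2^r with 3 ≤? r
    ...     | no r≱3 = contradiction (<-≤-trans (+-monoʳ-< (2 ^ r) c<2^r) (+-mono-≤ 2^r≤4 2^r≤4)) m≮8
      where
      2^r≤4 : 2 ^ r ≤ 4
      2^r≤4 = ^-monoʳ-≤ 2 (≤-pred (≰⇒> r≱3))
    ...     | yes r≥3 with m≤n⇒∃[o]m+o≡n r≥3
    ...       | n , refl with c ≤? jac (3 + n)
    ...         | yes c≤J = belowAllChords-rising n c≤J IH
    ...         | no  c≰J = belowAllChords-falling n (<⇒≤ (≰⇒> c≰J)) c<2^r IH

module PiecewiseLinear where
  open import Data.Bool.Base using (true; false; T)
  open import Data.Integer.Base as ℤ using (+_; +≤+)
  import Data.Integer.Properties as ℤ
  open import Data.Integer.Tactic.RingSolver using (solve-∀)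
  open import Data.Nat.Base
  open import Data.Nat.Properties
  open import Data.Rational.Base as ℚ using (ℚ; 0ℚ; 1ℚ; _÷_; 1/_)
  import Data.Rational.Properties as ℚ
  import Data.Rational.Unnormalised.Base as ℚᵘ
  import Data.Rational.Unnormalised.Properties as ℚᵘ
  open import Function.Base using (_∘_)
  open import Relation.Binary.PropositionalEquality hiding (J)
  open import Relation.Nullary.Decidable using (yes; no)
  open import Relation.Nullary.Negation using (contradiction)

  open import Defs
  open FibonacciJacobsthal
  open Chords
  open UpperBound

  private
    toℚ≤frac : ∀ {y N d} → 0 < d → + y ℤ.* + d ℤ.≤ N → toℚ y ℚ.≤ frac N d
    toℚ≤frac {y} {N} {suc d} _ y*d≤N = ℚ.toℚᵘ-cancel-≤
      (ℚᵘ.≤-respʳ-≃ (ℚᵘ.≃-sym (ℚ.toℚᵘ-fromℚᵘ (ℚᵘ.mkℚᵘ N d)))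
      (ℚᵘ.≤-respˡ-≃ (ℚᵘ.≃-sym (ℚ.toℚᵘ-fromℚᵘ (ℚᵘ.mkℚᵘ (+ y) 0)))
        (ℚᵘ.*≤* (subst (+ y ℤ.* + suc d ℤ.≤_) (sym (ℤ.*-identityʳ N)) y*d≤N))))

    frac-multiple : ∀ y {d} → 0 < d → frac (+ (y * d)) d ≡ toℚ y
    frac-multiple y {suc d} _ = ℚ.fromℚᵘ-cong {ℚᵘ.mkℚᵘ (+ (y * suc d)) d} {ℚᵘ.mkℚᵘ (+ y) 0}
      (ℚᵘ.*≡* (trans (ℤ.*-identityʳ (+ (y * suc d))) (ℤ.pos-* y (suc d))))

  segFrom-≥ : ∀ f n m → n ≤ segFrom f n m
  segFrom-≥ zero    n m = ≤-refl
  segFrom-≥ (suc f) n m with m <ᵇ mSeq (suc n)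
  ... | true  = ≤-refl
  ... | false = ≤-trans (n≤1+n n) (segFrom-≥ f (suc n) m)

  jac-segFrom-≤ : ∀ f n m → jac n ≤ m → jac (segFrom f n m) ≤ m
  jac-segFrom-≤ zero    n m jac≤m = jac≤m
  jac-segFrom-≤ (suc f) n m jac≤m with m <ᵇ mSeq (suc n) in m<ᵇ
  ... | true  = jac≤m
  ... | false = jac-segFrom-≤ f (suc n) m
    (subst (_≤ m) (mSeq≡jac (suc n)) (≮⇒≥ λ m< → subst T m<ᵇ (<⇒<ᵇ m<)))

  h≡chord : ∀ {m} → 1 ≤ m → let n = seg m in h m ≡ frac (chord n (+ m)) (jac (suc n) ∸ jac n)
  h≡chord {suc k} _ with seg (suc k) | jac-segFrom-≤ (suc k) 2 (suc k) (s≤s z≤n)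
  ... | n | jac≤m rewrite mSeq≡jac n | mSeq≡jac (suc n) | a-jac n | a-jac (suc n) =
    cong (λ N → frac N (jac (suc n) ∸ jac n))
         (cong₂ ℤ._+_ (trans (ℤ.pos-* (fib n) _) (cong (F n ℤ.*_) (pos-∸ (jac-step-mono n))))
                      (cong (ℤ._* rise n) (pos-∸ jac≤m)))

  segFrom-jac : ∀ i f k → 2 ≤ k → i ≤ f → segFrom f k (jac (i + k)) ≡ i + k
  segFrom-jac zero zero    k _ _ = refl
  segFrom-jac zero (suc f) (suc zero) (s≤s ()) _
  segFrom-jac zero (suc f) (suc (suc k)) _ _ with jac (2 + k) <ᵇ mSeq (3 + k) in jac<ᵇ
  ... | true  = refl
  ... | false = contradiction (subst (jac (2 + k) <_) (sym (mSeq≡jac (3 + k))) (jac-strict k))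
                              (λ lt → subst T jac<ᵇ (<⇒<ᵇ lt))
  segFrom-jac (suc i) (suc f) k 2≤k (s≤s i≤f) with jac (suc (i + k)) <ᵇ mSeq (suc k) in jac<ᵇ
  ... | true  = contradiction (<ᵇ⇒< _ _ (subst T (sym jac<ᵇ) _))
    (≤⇒≯ (subst (_≤ jac (suc (i + k))) (sym (mSeq≡jac (suc k))) (jac-mono-≤ (s≤s (m≤n+m k i)))))
  ... | false = begin
    segFrom f (suc k) (jac (suc (i + k)))  ≡⟨ cong (λ j → segFrom f (suc k) (jac j)) (+-suc i k) ⟨
    segFrom f (suc k) (jac (i + suc k))    ≡⟨ segFrom-jac i f (suc k) (m≤n⇒m≤1+n 2≤k) i≤f ⟩
    i + suc k                              ≡⟨ +-suc i k ⟩
    suc (i + k)                            ∎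
    where open ≡-Reasoning

  seg-jac : ∀ n → seg (jac (2 + n)) ≡ 2 + n
  seg-jac n = begin
    segFrom (jac (2 + n)) 2 (jac (2 + n))  ≡⟨ cong (λ j → segFrom (jac (2 + n)) 2 (jac j)) (+-comm 2 n) ⟩
    segFrom (jac (2 + n)) 2 (jac (n + 2))  ≡⟨ segFrom-jac n (jac (2 + n)) 2 ≤-refl (n≤jac[2+n] n) ⟩
    n + 2                                  ≡⟨ +-comm n 2 ⟩
    2 + n                                  ∎
    where open ≡-Reasoning

  private
    0<jac[1+n]∸jac[n] : ∀ {n} → 2 ≤ n → 0 < jac (suc n) ∸ jac n
    0<jac[1+n]∸jac[n] {n} 2≤n = ℤ.drop‿+<+ (subst (ℤ.0ℤ ℤ.<_) (sym (pos-∸ (jac-step-mono n))) (run-positive 2≤n))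

    0≤toℚ : ∀ n → 0ℚ ℚ.≤ toℚ n
    0≤toℚ n = ℚ.nonNegative⁻¹ (toℚ n) {{ℚ.normalize-nonNeg n 1}}

    ÷≤1 : ∀ {p q} (q≢0 : q ≢ 0ℚ) → 0ℚ ℚ.≤ p → p ℚ.≤ q → (p ÷ q) {{ℚ.≢-nonZero q≢0}} ℚ.≤ 1ℚ
    ÷≤1 {p} {q} q≢0 0≤p p≤q = begin
      p ℚ.* 1/q    ≤⟨ ℚ.*-monoʳ-≤-nonNeg 1/q {{1/q-nonNeg}} p≤q ⟩
      q ℚ.* 1/q    ≡⟨ ℚ.*-inverseʳ q {{ℚ.≢-nonZero q≢0}} ⟩
      1ℚ           ∎
      where
      open ℚ.≤-Reasoning
      1/q : ℚ
      1/q = (1/ q) {{ℚ.≢-nonZero q≢0}}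
      1/q-nonNeg : ℚ.NonNegative 1/q
      1/q-nonNeg = ℚ.pos⇒nonNeg 1/q {{ℚ.1/pos⇒pos q {{q-pos}}}}
        where
        q-pos : ℚ.Positive q
        q-pos = ℚ.nonNeg∧nonZero⇒pos q {{ℚ.nonNegative (ℚ.≤-trans 0≤p p≤q)}} {{ℚ.≢-nonZero q≢0}}

  a≤h : ∀ m → toℚ (a m) ℚ.≤ h m
  a≤h zero        = ℚ.≤-refl
  a≤h m@(suc _) = subst (toℚ (a m) ℚ.≤_) (sym (h≡chord {m} (s≤s z≤n))) (toℚ≤frac {a m} (0<jac[1+n]∸jac[n] 2≤n)
    (subst (λ d → + a m ℤ.* d ℤ.≤ chord n (+ m)) (sym (pos-∸ (jac-step-mono n))) (belowAllChords m n 2≤n)))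
    where
    n = seg m
    2≤n : 2 ≤ n
    2≤n = segFrom-≥ m 2 m

  h-jac : ∀ n → h (jac (2 + n)) ≡ toℚ (fib (2 + n))
  h-jac n = begin
    h (jac (2 + n))                           ≡⟨ h≡chord {jac (2 + n)} (jac-mono-≤ {1} {2 + n} (s≤s z≤n)) ⟩
    frac (chord k (J (2 + n))) (jac (suc k) ∸ jac k)
                                              ≡⟨ cong (λ k → frac (chord k (J (2 + n))) (jac (suc k) ∸ jac k)) (seg-jac n) ⟩
    frac (chord (2 + n) (J (2 + n))) d        ≡⟨ cong (λ N → frac N d) chord-node ⟩
    frac (+ (fib (2 + n) * d)) d              ≡⟨ frac-multiple (fib (2 + n)) (0<jac[1+n]∸jac[n] {2 + n} (s≤s (s≤s z≤n))) ⟩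
    toℚ (fib (2 + n))                         ∎
    where
    open ≡-Reasoning
    k = seg (jac (2 + n))
    d = jac (3 + n) ∸ jac (2 + n)
    chord-node : chord (2 + n) (J (2 + n)) ≡ + (fib (2 + n) * d)
    chord-node = trans (cancel (F (2 + n)) (run (2 + n)) (J (2 + n)) (rise (2 + n)))
                       (trans (cong (F (2 + n) ℤ.*_) (sym (pos-∸ (jac-step-mono (2 + n))))) (sym (ℤ.pos-* (fib (2 + n)) d)))
      where
      cancel : ∀ f r j s → f ℤ.* r ℤ.+ (j ℤ.- j) ℤ.* s ≡ f ℤ.* r
      cancel = solve-∀

  ratio≤1 : ∀ m → ratio m ℚ.≤ 1ℚ
  ratio≤1 m with h m ℚ.≟ 0ℚ
  ... | yes _   = ℚ.*≤* (+≤+ z≤n)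
  ... | no h≢0 = ÷≤1 h≢0 (0≤toℚ (a m)) (a≤h m)

  ratio-jac : ∀ n → ratio (jac (2 + n)) ≡ 1ℚ
  ratio-jac n with h (jac (2 + n)) ℚ.≟ 0ℚ
  ... | yes h≡0 = contradiction (trans (sym (h-jac n)) h≡0) (ℚ.<⇒≢ fib>0 ∘ sym)
    where
    fib>0 : 0ℚ ℚ.< toℚ (fib (2 + n))
    fib>0 = ℚ.positive⁻¹ _ {{ℚ.normalize-pos (fib (2 + n)) 1 {{_}} {{>-nonZero (fib-pos (suc n))}}}}
  ... | no h≢0 = trans (cong (ℚ._* (1/ h (jac (2 + n))) {{ℚ.≢-nonZero h≢0}}) a≡h)
                       (ℚ.*-inverseʳ (h (jac (2 + n))) {{ℚ.≢-nonZero h≢0}})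
    where
    a≡h : toℚ (a (jac (2 + n))) ≡ h (jac (2 + n))
    a≡h = trans (cong toℚ (a-jac (2 + n))) (sym (h-jac n))


open import Defs
open import Data.Product using (_×_; _,_; ∃)
open import Data.Nat using (ℕ)
open import Data.Rational using (_≤_; 1ℚ)
import Data.Nat as ℕ
import Data.Rational as ℚ
import Data.Rational.Properties as ℚ
open import Relation.Binary.PropositionalEquality using (subst; sym)

open FibonacciJacobsthal using (jac; n≤jac[2+n])
open PiecewiseLinear using (a≤h; ratio≤1; ratio-jac)

lemma2 : ((m : ℕ) → toℚ (a m) ≤ h m) × LimsupEq ratio 1ℚ
lemma2 = a≤h , eventually-below , infinitely-often-above
  where
  eventually-below : ∀ ε → ℚ.0ℚ ℚ.< ε → ∃ λ N → ∀ m → N ℕ.≤ m → ratio m ℚ.< 1ℚ ℚ.+ ε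
  eventually-below ε ε>0 = 0 , λ m _ → ℚ.≤-<-trans (ratio≤1 m) (ℚ.+-mono-≤-< (ℚ.≤-refl {1ℚ}) ε>0)
  infinitely-often-above : ∀ ε → ℚ.0ℚ ℚ.< ε → ∀ N → ∃ λ m → N ℕ.≤ m × 1ℚ ℚ.- ε ℚ.< ratio m
  infinitely-often-above ε ε>0 N = jac (2 ℕ.+ N) , n≤jac[2+n] N ,
    subst (1ℚ ℚ.- ε ℚ.<_) (sym (ratio-jac N)) (ℚ.+-mono-≤-< (ℚ.≤-refl {1ℚ}) (ℚ.neg-antimono-< ε>0))
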